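{- Consider an instance of the destructive weighted-\$-protection problem. Suppose the defender succeeds by awarding a set $\mathcal V_F\subseteq\mathcal V$ (with $\sum_{v_j\in\mathcal V_F}p^a_j\le F$). If $v_{j'}\prec v_j$, $v_{j'}\in\mathcal V_F$ and $v_j\notin\mathcal V_F$, then the defender also succeeds by awarding $(\mathcal V_F\setminus\{v_{j'}\})\cup\{v_j\}$.
   Context: An election has candidates $c_1,\dots,c_m$ and voters $\mathcal V=\{v_1,\dots,v_n\}$; voter $v_j$ has a preference list $\tau_j$, weight $w_j\in\mathbb Z_{>0}$, awarding price $p^a_j$ and bribing price $p^b_j$. Under a scoring rule $\alpha_1\ge\dots\ge\alpha_m$ (nonnegative integers), $v_j$ gives $w_j\alpha_z$ points to the candidate in position $z$ of its list; $c_m$ is the winner without bribery. The defender with budget $F$ awards $\mathcal V_F$ with total awarding price $\le F$; the attacker with budget $B$ bribes $\mathcal V_B\subseteq\mathcal V\setminus\mathcal V_F$ with total bribing price $\le B$ and replaces the lists of bribed voters arbitrarily. The defender succeeds with $\mathcal V_F$ if for every such $\mathcal V_B$ and new lists, no $c\neq c_m$ gets a score strictly higher than $c_m$. Dominance: $v_{j'}\prec v_j$ if either (i) $\tau_j=\tau_{j'}$, $w_j\ge w_{j'}$, $p^a_j\le p^a_{j'}$, $p^b_j\le p^b_{j'}$ with at least one strict inequality; or (ii) $\tau_j=\tau_{j'}$, $w_j=w_{j'}$, $p^a_j=p^a_{j'}$, $p^b_j=p^b_{j'}$ and $j'<j$. -}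

module Defs where

open import Data.Nat using (ℕ; zero; suc; _+_; _*_; _≤_; _<_)
open import Data.Bool using (if_then_else_)
open import Data.Fin as Fin using (Fin; fromℕ)
open import Data.Fin.Subset using (Subset; _∈_; _∉_; _-_; _∪_; ⁅_⁆)
open import Data.Vec using (Vec; lookup)
open import Data.Vec.Relation.Unary.Unique.Propositional using (Unique)
open import Data.Product using (_×_; Σ)
open import Data.Sum using (_⊎_)
open import Relation.Nullary.Decidable using (⌊_⌋)
open import Relation.Binary.PropositionalEquality using (_≡_)

∑ : ∀ {n} → (Fin n → ℕ) → ℕ
∑ {zero}  f = 0
∑ {suc n} f = f Fin.zero + ∑ (λ i → f (Fin.suc i))

-- A preference list over m candidates: position z ↦ candidate at position z,
-- a vector of length m with pairwise distinct entries (i.e. a permutation).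
PrefList : ℕ → Set
PrefList m = Vec (Fin m) m

-- An election instance with m = suc k candidates c_1..c_m (c_m = fromℕ k)
-- and n voters.
record Instance : Set where
  field
    k n    : ℕ
    τ      : Fin n → PrefList (suc k)
    τ-ok   : ∀ j → Unique (τ j)
    w      : Fin n → ℕ
    w-pos  : ∀ j → 0 < w j
    pa pb  : Fin n → ℕ                -- awarding / bribing prices
    α      : Fin (suc k) → ℕ
    α-mono : ∀ (y z : Fin (suc k)) → y Fin.≤ z → α z ≤ α y
    F B    : ℕ                        -- defender / attacker budgets

cm : ∀ {k} → Fin (suc k)
cm {k} = fromℕ k

cost : ∀ {n} → (Fin n → ℕ) → Subset n → ℕ
cost p S = ∑ (λ j → if lookup S j then p j else 0)

score : ∀ {n m} → (Fin n → ℕ) → (Fin m → ℕ) → (Fin n → PrefList m) → Fin m → ℕ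
score w α P c = ∑ (λ j → ∑ (λ z → if ⌊ lookup (P j) z Fin.≟ c ⌋ then w j * α z else 0))

module _ (I : Instance) where
  open Instance I

  Succeeds : Subset n → Set
  Succeeds VF =
    cost pa VF ≤ F ×
    (∀ (VB : Subset n) → (∀ j → j ∈ VB → j ∉ VF) → cost pb VB ≤ B →
     ∀ (P : Fin n → PrefList (suc k)) → (∀ j → Unique (P j)) →
     (∀ j → j ∉ VB → P j ≡ τ j) →
     ∀ (c : Fin (suc k)) → c ≢ cm → score w α P c ≤ score w α P cm)
    where open import Relation.Binary.PropositionalEquality using (_≢_)

  -- dominance  v_{j'} ≺ v_j   (written  Dominated j' j)
  Dominated : Fin n → Fin n → Set
  Dominated j' j =
    (τ j ≡ τ j' × w j' ≤ w j × pa j ≤ pa j' × pb j ≤ pb j' ×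
       (w j' < w j ⊎ pa j < pa j' ⊎ pb j < pb j'))
    ⊎
    (τ j ≡ τ j' × w j ≡ w j' × pa j ≡ pa j' × pb j ≡ pb j' × j' Fin.< j)

-- If an attack on the new award set does not bribe j', it is already an attack on VF.  Otherwise it
-- gives j' some list X while j keeps its honest list L = τ j = τ j'.  Against VF the attacker could
-- instead (a) bribe j with X and leave j' honest, affordable as pb j ≤ pb j', or (b) just leave j'
-- honest.  Because w j' ≤ w j, the lead of c_m under the actual attack is at least its lead under (a)
-- or under (b), according to whether X or L favours c_m more; both leads are nonnegative as VF succeeds.
module Submission where

open import Defs
open import Data.Bool using (true; false; if_then_else_)
open import Data.Fin as Fin using (Fin; _≟_)
open import Data.Fin.Subset using (Subset; inside; outside; _∈_; _∉_; _⊆_; _─_; _-_; _∪_; ⁅_⁆)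
open import Data.Fin.Subset.Properties
  using (_∈?_; x∈⁅x⁆; x∈⁅y⁆⇒x≡y; x∉⁅y⁆⇒x≢y; x∈p∪q⁻; x∈p∪q⁺; p─q⊆p; x∈p∧x≢y⇒x∈p-y)
open import Data.Nat using (ℕ; zero; suc; _+_; _*_; _≤_; z≤n)
open import Data.Nat.Properties hiding (_≟_)
open import Data.Nat.Tactic.RingSolver using (solve)
open import Data.List using (_∷_; [])
open import Data.Product using (_×_; _,_; proj₁)
open import Data.Sum as Sum using (_⊎_; inj₁; inj₂; [_,_]′)
open import Data.Vec as Vec using (here; there; lookup)
open import Data.Vec.Properties using ([]=⇒lookup; lookup⇒[]=)
open import Data.Vec.Functional using (Vector; updateAt)
open import Data.Vec.Functional.Properties using (updateAt-updates; updateAt-minimal)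
open import Data.Vec.Relation.Unary.Unique.Propositional using (Unique)
open import Function using (_∘_; const)
open import Relation.Nullary using (yes; no; contradiction)
open import Relation.Nullary.Decidable using (⌊_⌋)
open import Relation.Binary.PropositionalEquality

∑-cong : ∀ {n} {f g : Fin n → ℕ} → f ≗ g → ∑ f ≡ ∑ g
∑-cong {zero}  f≗g = refl
∑-cong {suc n} f≗g = cong₂ _+_ (f≗g Fin.zero) (∑-cong (f≗g ∘ Fin.suc))

∑-mono-≤ : ∀ {n} {f g : Fin n → ℕ} → (∀ i → f i ≤ g i) → ∑ f ≤ ∑ g
∑-mono-≤ {zero}  f≤g = z≤n
∑-mono-≤ {suc n} f≤g = +-mono-≤ (f≤g Fin.zero) (∑-mono-≤ (f≤g ∘ Fin.suc))

*-distribˡ-∑ : ∀ {n} c (f : Fin n → ℕ) → c * ∑ f ≡ ∑ (λ i → c * f i)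
*-distribˡ-∑ {zero}  c f = *-zeroʳ c
*-distribˡ-∑ {suc n} c f =
  trans (*-distribˡ-+ c (f Fin.zero) _) (cong (c * f Fin.zero +_) (*-distribˡ-∑ c (f ∘ Fin.suc)))

erase : ∀ {n} → Fin n → Vector ℕ n → Vector ℕ n
erase i f = updateAt f i (const 0)

∑-erase : ∀ {n} (f : Fin n → ℕ) i → ∑ f ≡ ∑ (erase i f) + f i
∑-erase {suc n} f Fin.zero    = +-comm (f Fin.zero) _
∑-erase {suc n} f (Fin.suc i) =
  trans (cong (f Fin.zero +_) (∑-erase (f ∘ Fin.suc) i)) (sym (+-assoc (f Fin.zero) _ _))

erase₂-cong : ∀ {n} {i j : Fin n} {f g : Fin n → ℕ} → (∀ l → l ≢ i → l ≢ j → f l ≡ g l) →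
  erase i (erase j f) ≗ erase i (erase j g)
erase₂-cong {i = i} {j} {f} {g} f≡g l with l ≟ i | l ≟ j
... | yes refl | _ = trans (updateAt-updates i (erase j f)) (sym (updateAt-updates i (erase j g)))
... | no l≢i | yes refl = begin
  erase i (erase l f) l ≡⟨ updateAt-minimal l i (erase l f) l≢i ⟩
  erase l f l           ≡⟨ updateAt-updates l f ⟩
  0                     ≡⟨ updateAt-updates l g ⟨
  erase l g l           ≡⟨ updateAt-minimal l i (erase l g) l≢i ⟨
  erase i (erase l g) l ∎
  where open ≡-Reasoning
... | no l≢i | no l≢j = begin
  erase i (erase j f) l ≡⟨ updateAt-minimal l i (erase j f) l≢i ⟩
  erase j f l           ≡⟨ updateAt-minimal l j f l≢j ⟩
  f l                   ≡⟨ f≡g l l≢i l≢j ⟩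
  g l                   ≡⟨ updateAt-minimal l j g l≢j ⟨
  erase j g l           ≡⟨ updateAt-minimal l i (erase j g) l≢i ⟨
  erase i (erase j g) l ∎
  where open ≡-Reasoning

∑-erase₂ : ∀ {n} {i j : Fin n} (f g : Fin n → ℕ) → i ≢ j → (∀ l → l ≢ i → l ≢ j → f l ≡ g l) →
  ∑ g ≡ ∑ (erase i (erase j f)) + g i + g j
∑-erase₂ {i = i} {j} f g i≢j f≡g = begin
  ∑ g                                         ≡⟨ ∑-erase g j ⟩
  ∑ (erase j g) + g j                         ≡⟨ cong (_+ g j) (∑-erase (erase j g) i) ⟩
  ∑ (erase i (erase j g)) + erase j g i + g j ≡⟨ cong₂ (λ s t → s + t + g j) (∑-cong (sym ∘ erase₂-cong f≡g))
                                                                          (updateAt-minimal i j g i≢j) ⟩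
  ∑ (erase i (erase j f)) + g i + g j         ∎
  where open ≡-Reasoning

∀-updateAt : ∀ {A : Set} (P : A → Set) {n} (xs : Vector A n) (i : Fin n) {f : A → A} →
  (∀ l → P (xs l)) → (P (xs i) → P (f (xs i))) → ∀ l → P (updateAt xs i f l)
∀-updateAt P {suc n} xs Fin.zero    all f-pres Fin.zero    = f-pres (all Fin.zero)
∀-updateAt P {suc n} xs Fin.zero    all f-pres (Fin.suc l) = all (Fin.suc l)
∀-updateAt P {suc n} xs (Fin.suc i) all f-pres Fin.zero    = all Fin.zero
∀-updateAt P {suc n} xs (Fin.suc i) all f-pres (Fin.suc l) =
  ∀-updateAt P (xs ∘ Fin.suc) i (all ∘ Fin.suc) f-pres l

x∈p─q⇒x∉q : ∀ {n} {x : Fin n} (p q : Subset n) → x ∈ p ─ q → x ∉ q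
x∈p─q⇒x∉q (inside Vec.∷ p) (outside Vec.∷ q) here          ()
x∈p─q⇒x∉q (_ Vec.∷ p)      (_ Vec.∷ q)       (there x∈p─q) (there x∈q) = x∈p─q⇒x∉q p q x∈p─q x∈q

x∈p-y⁻ : ∀ {n} {x y : Fin n} {p : Subset n} → x ∈ p - y → x ∈ p × x ≢ y
x∈p-y⁻ {y = y} {p} x∈p-y = p─q⊆p p ⁅ y ⁆ x∈p-y , x∉⁅y⁆⇒x≢y (x∈p─q⇒x∉q p ⁅ y ⁆ x∈p-y)

exchange : ∀ {n} → Subset n → Fin n → Fin n → Subset n
exchange S i j = (S - i) ∪ ⁅ j ⁆

module _ {n} {S : Subset n} {i j : Fin n} where

  ∈-exchange⁻ : ∀ {x} → x ∈ exchange S i j → (x ∈ S × x ≢ i) ⊎ x ≡ j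
  ∈-exchange⁻ x∈T = Sum.map x∈p-y⁻ (x∈⁅y⁆⇒x≡y j) (x∈p∪q⁻ (S - i) ⁅ j ⁆ x∈T)

  ∈-exchange⁺ : ∀ {x} → x ∈ S → x ≢ i → x ∈ exchange S i j
  ∈-exchange⁺ x∈S x≢i = x∈p∪q⁺ (inj₁ (x∈p∧x≢y⇒x∈p-y x∈S x≢i))

  new∈exchange : j ∈ exchange S i j
  new∈exchange = x∈p∪q⁺ (inj₂ (x∈⁅x⁆ j))

  old∉exchange : j ≢ i → i ∉ exchange S i j
  old∉exchange j≢i i∈T = [ (λ (_ , i≢i) → i≢i refl) , j≢i ∘ sym ]′ (∈-exchange⁻ i∈T)

charge : ∀ {n} → (Fin n → ℕ) → Subset n → Fin n → ℕ
charge p S l = if lookup S l then p l else 0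

module _ {n} (p : Fin n → ℕ) where

  charge-∈ : ∀ {S x} → x ∈ S → charge p S x ≡ p x
  charge-∈ x∈S rewrite []=⇒lookup x∈S = refl

  charge-∉ : ∀ {S x} → x ∉ S → charge p S x ≡ 0
  charge-∉ {S} {x} x∉S with lookup S x in eq
  ... | true  = contradiction (lookup⇒[]= x S eq) x∉S
  ... | false = refl

  charge-cong : ∀ {S S' x} → (x ∈ S → x ∈ S') → (x ∈ S' → x ∈ S) → charge p S x ≡ charge p S' x
  charge-cong {S} {S'} {x} to from with x ∈? S
  ... | yes x∈S = trans (charge-∈ x∈S) (sym (charge-∈ (to x∈S)))
  ... | no  x∉S = trans (charge-∉ x∉S) (sym (charge-∉ (x∉S ∘ from)))

  cost-mono-⊆ : ∀ {S S'} → S ⊆ S' → cost p S ≤ cost p S'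
  cost-mono-⊆ {S} {S'} S⊆S' = ∑-mono-≤ charge-≤
    where
    charge-≤ : ∀ x → charge p S x ≤ charge p S' x
    charge-≤ x with x ∈? S
    ... | yes x∈S = ≤-reflexive (trans (charge-∈ x∈S) (sym (charge-∈ (S⊆S' x∈S))))
    ... | no  x∉S = ≤-trans (≤-reflexive (charge-∉ x∉S)) z≤n

  cost-exchange-≤ : ∀ {S i j} → i ∈ S → j ∉ S → p j ≤ p i → cost p (exchange S i j) ≤ cost p S
  cost-exchange-≤ {S} {i} {j} i∈S j∉S pj≤pi = begin
    cost p T                             ≡⟨ ∑-erase₂ (charge p S) (charge p T) j≢i agree ⟩
    R + charge p T j + charge p T i      ≡⟨ cong₂ (λ a b → R + a + b) (charge-∈ (new∈exchange {S = S} {i}))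
                                                                     (charge-∉ (old∉exchange {S = S} j≢i)) ⟩
    R + p j + 0                          ≡⟨ +-identityʳ (R + p j) ⟩
    R + p j                              ≤⟨ +-monoʳ-≤ R pj≤pi ⟩
    R + p i                              ≡⟨ cong (_+ p i) (+-identityʳ R) ⟨
    R + 0 + p i                          ≡⟨ cong₂ (λ a b → R + a + b) (charge-∉ j∉S) (charge-∈ i∈S) ⟨
    R + charge p S j + charge p S i      ≡⟨ ∑-erase₂ (charge p S) (charge p S) j≢i (λ _ _ _ → refl) ⟨
    cost p S                             ∎
    where
    open ≤-Reasoning
    T = exchange S i j
    R = ∑ (erase j (erase i (charge p S)))
    j≢i : j ≢ i
    j≢i refl = j∉S i∈S
    agree : ∀ l → l ≢ j → l ≢ i → charge p S l ≡ charge p T l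
    agree l l≢j l≢i = charge-cong (λ l∈S → ∈-exchange⁺ {j = j} l∈S l≢i)
                                  ([ proj₁ , (λ l≡j → contradiction l≡j l≢j) ]′ ∘ ∈-exchange⁻ {S = S})

*-if : ∀ c b a → (if b then c * a else 0) ≡ c * (if b then a else 0)
*-if c true  a = refl
*-if c false a = sym (*-zeroʳ c)

-- The slack of the goal is that of the copied hypothesis plus a·((x' + y) − (x + y')), and also that
-- of the swapped one plus (b − a)·((x + y') − (x' + y)); one of the two corrections is nonnegative.
≤-of-swapped-and-copied : ∀ {a b} r r' x x' y y' → a ≤ b →
  r + b * x + a * y ≤ r' + b * x' + a * y' →
  r + b * y + a * y ≤ r' + b * y' + a * y' →
  r + b * y + a * x ≤ r' + b * y' + a * x'
≤-of-swapped-and-copied {a} {b} r r' x x' y y' a≤b swapped copied with ≤-total (x + y') (x' + y)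
... | inj₁ x+y'≤x'+y = +-cancelʳ-≤ (a * (y + y')) _ _ (begin
  r + b * y + a * x + a * (y + y')    ≡⟨ solve (r ∷ b ∷ y ∷ a ∷ x ∷ y' ∷ []) ⟩
  r + b * y + a * y + a * (x + y')    ≤⟨ +-mono-≤ copied (*-monoʳ-≤ a x+y'≤x'+y) ⟩
  r' + b * y' + a * y' + a * (x' + y) ≡⟨ solve (r' ∷ b ∷ y' ∷ a ∷ x' ∷ y ∷ []) ⟩
  r' + b * y' + a * x' + a * (y + y') ∎)
  where open ≤-Reasoning
... | inj₂ x'+y≤x+y' with m≤n⇒∃[o]m+o≡n a≤b
... | d , refl = +-cancelʳ-≤ (d * (x + x')) _ _ (begin
  r + (a + d) * y + a * x + d * (x + x')    ≡⟨ solve (r ∷ a ∷ d ∷ y ∷ x ∷ x' ∷ []) ⟩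
  r + (a + d) * x + a * y + d * (x' + y)    ≤⟨ +-mono-≤ swapped (*-monoʳ-≤ d x'+y≤x+y') ⟩
  r' + (a + d) * x' + a * y' + d * (x + y') ≡⟨ solve (r' ∷ a ∷ d ∷ y' ∷ x' ∷ x ∷ []) ⟩
  r' + (a + d) * y' + a * x' + d * (x + x') ∎)
  where open ≤-Reasoning

points : ∀ {m} → (Fin m → ℕ) → PrefList m → Fin m → ℕ
points α L d = ∑ (λ z → if ⌊ lookup L z ≟ d ⌋ then α z else 0)

module _ {n m} (w : Fin n → ℕ) (α : Fin m → ℕ) where

  score≡∑points : ∀ P d → score w α P d ≡ ∑ (λ l → w l * points α (P l) d)
  score≡∑points P d = ∑-cong λ l →
    trans (∑-cong (λ z → *-if (w l) _ (α z)))
          (sym (*-distribˡ-∑ (w l) (λ z → if ⌊ lookup (P l) z ≟ d ⌋ then α z else 0)))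

  score-erase₂ : ∀ (P Q : Fin n → PrefList m) {i j} → i ≢ j → (∀ l → l ≢ i → l ≢ j → P l ≡ Q l) → ∀ d →
    score w α Q d ≡ ∑ (erase i (erase j (λ l → w l * points α (P l) d)))
                    + w i * points α (Q i) d + w j * points α (Q j) d
  score-erase₂ P Q i≢j P≡Q d = trans (score≡∑points Q d)
    (∑-erase₂ _ _ i≢j (λ l l≢i l≢j → cong (λ L → w l * points α L d) (P≡Q l l≢i l≢j)))

module _ (I : Instance) where
  open Instance I

  record WeaklyDominated (j' j : Fin n) : Set where
    constructor weaklyDominated
    field
      same-list          : τ j ≡ τ j'
      weight-≤           : w j' ≤ w j
      awarding-price-≤   : pa j ≤ pa j'
      bribing-price-≤    : pb j ≤ pb j'

  Dominated⇒WeaklyDominated : ∀ {j' j} → Dominated I j' j → WeaklyDominated j' j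
  Dominated⇒WeaklyDominated (inj₁ (τ≡ , w≤ , pa≤ , pb≤ , _)) = weaklyDominated τ≡ w≤ pa≤ pb≤
  Dominated⇒WeaklyDominated (inj₂ (τ≡ , w≡ , pa≡ , pb≡ , _)) =
    weaklyDominated τ≡ (≤-reflexive (sym w≡)) (≤-reflexive pa≡) (≤-reflexive pb≡)

  record Bribery (VF : Subset n) : Set where
    field
      bribed            : Subset n
      bribed-unawarded  : ∀ l → l ∈ bribed → l ∉ VF
      bribed-affordable : cost pb bribed ≤ B
      profile           : Fin n → PrefList (suc k)
      profile-unique    : ∀ l → Unique (profile l)
      profile-unbribed  : ∀ l → l ∉ bribed → profile l ≡ τ l

  Withstands : Subset n → Set
  Withstands VF = (β : Bribery VF) → ∀ c → c ≢ cm →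
    score w α (Bribery.profile β) c ≤ score w α (Bribery.profile β) cm

  Succeeds⇒Withstands : ∀ {VF} → Succeeds I VF → Withstands VF
  Succeeds⇒Withstands (_ , safe) β =
    safe bribed bribed-unawarded bribed-affordable profile profile-unique profile-unbribed
    where open Bribery β

  Withstands⇒Succeeds : ∀ {VF} → cost pa VF ≤ F → Withstands VF → Succeeds I VF
  Withstands⇒Succeeds affordable withstands =
    affordable , λ VB disjoint VB-affordable P unique unbribed →
      withstands (record { bribed = VB ; bribed-unawarded = disjoint ; bribed-affordable = VB-affordable
                         ; profile = P ; profile-unique = unique ; profile-unbribed = unbribed })

  module Exchange {VF : Subset n} {j' j : Fin n} (j'∈VF : j' ∈ VF) (j∉VF : j ∉ VF)
                  (j'≺j : WeaklyDominated j' j) where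
    open WeaklyDominated j'≺j

    j≢j' : j ≢ j'
    j≢j' refl = j∉VF j'∈VF

    exchange-affordable : cost pa (exchange VF j' j) ≤ cost pa VF
    exchange-affordable = cost-exchange-≤ pa j'∈VF j∉VF awarding-price-≤

    L : Fin (suc k) → ℕ
    L = points α (τ j')

    module _ (β : Bribery (exchange VF j' j)) where
      open Bribery β

      unawarded-unless-j' : ∀ l → l ∈ bribed → l ≢ j' → l ∉ VF
      unawarded-unless-j' l l∈VB l≢j' l∈VF = bribed-unawarded l l∈VB (∈-exchange⁺ l∈VF l≢j')

      j∉bribed : j ∉ bribed
      j∉bribed j∈VB = bribed-unawarded j j∈VB (new∈exchange {S = VF} {j'})

      against-VF : j' ∉ bribed → Bribery VF
      against-VF j'∉VB = record
        { bribed-unawarded = λ l l∈VB → unawarded-unless-j' l l∈VB (λ { refl → j'∉VB l∈VB })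
        ; bribed-affordable = bribed-affordable ; profile-unique = profile-unique
        ; profile-unbribed = profile-unbribed }

      honest-j' : Fin n → PrefList (suc k)
      honest-j' = updateAt profile j' (const (τ j'))

      honest-j'-unique : ∀ l → Unique (honest-j' l)
      honest-j'-unique = ∀-updateAt Unique profile j' profile-unique (const (τ-ok j'))

      honest-j'-unbribed : ∀ l → (l ≢ j' → l ∉ bribed) → honest-j' l ≡ τ l
      honest-j'-unbribed l l∉VB with l ≟ j'
      ... | yes refl = updateAt-updates j' profile
      ... | no l≢j'  = trans (updateAt-minimal l j' profile l≢j') (profile-unbribed l (l∉VB l≢j'))

      leave-j'-honest : Bribery VF
      leave-j'-honest = record
        { bribed = bribed - j'
        ; bribed-unawarded = λ l l∈VB-j' → let (l∈VB , l≢j') = x∈p-y⁻ l∈VB-j' in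
                                           unawarded-unless-j' l l∈VB l≢j'
        ; bribed-affordable = ≤-trans (cost-mono-⊆ pb (p─q⊆p bribed ⁅ j' ⁆)) bribed-affordable
        ; profile = honest-j'
        ; profile-unique = honest-j'-unique
        ; profile-unbribed = λ l l∉VB-j' →
            honest-j'-unbribed l (λ l≢j' l∈VB → l∉VB-j' (x∈p∧x≢y⇒x∈p-y l∈VB l≢j'))
        }

      j-bribed-instead : Fin n → PrefList (suc k)
      j-bribed-instead = updateAt honest-j' j (const (profile j'))

      bribe-j-instead : j' ∈ bribed → Bribery VF
      bribe-j-instead j'∈VB = record
        { bribed = exchange bribed j' j
        ; bribed-unawarded = λ l l∈T → [ (λ (l∈VB , l≢j') → unawarded-unless-j' l l∈VB l≢j')
                                       , (λ { refl → j∉VF }) ]′ (∈-exchange⁻ l∈T)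
        ; bribed-affordable =
            ≤-trans (cost-exchange-≤ pb j'∈VB j∉bribed bribing-price-≤) bribed-affordable
        ; profile = j-bribed-instead
        ; profile-unique = ∀-updateAt Unique honest-j' j honest-j'-unique (const (profile-unique j'))
        ; profile-unbribed = unbribed
        }
        where
        unbribed : ∀ l → l ∉ exchange bribed j' j → j-bribed-instead l ≡ τ l
        unbribed l l∉T with l ≟ j
        ... | yes refl = contradiction (new∈exchange {S = bribed} {j'}) l∉T
        ... | no l≢j   = trans (updateAt-minimal l j honest-j' l≢j)
                               (honest-j'-unbribed l (λ l≢j' l∈VB → l∉T (∈-exchange⁺ l∈VB l≢j')))

      R X : Fin (suc k) → ℕ
      R d = ∑ (erase j (erase j' (λ l → w l * points α (profile l) d)))
      X = points α (profile j')

      profile-j : profile j ≡ τ j'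
      profile-j = trans (profile-unbribed j j∉bribed) same-list

      honest-j'-j : honest-j' j ≡ τ j'
      honest-j'-j = trans (updateAt-minimal j j' profile j≢j') profile-j

      honest-j'-elsewhere : ∀ l → l ≢ j → l ≢ j' → profile l ≡ honest-j' l
      honest-j'-elsewhere l _ l≢j' = sym (updateAt-minimal l j' profile l≢j')

      score-actual : ∀ d → score w α profile d ≡ R d + w j * L d + w j' * X d
      score-actual d = trans (score-erase₂ w α profile profile j≢j' (λ _ _ _ → refl) d)
                             (cong (λ M → R d + w j * points α M d + w j' * X d) profile-j)

      score-honest-j' : ∀ d → score w α honest-j' d ≡ R d + w j * L d + w j' * L d
      score-honest-j' d = trans (score-erase₂ w α profile honest-j' j≢j' honest-j'-elsewhere d)
        (cong₂ (λ M N → R d + w j * points α M d + w j' * points α N d)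
               honest-j'-j (updateAt-updates j' profile))

      score-j-bribed-instead : ∀ d → score w α j-bribed-instead d ≡ R d + w j * X d + w j' * L d
      score-j-bribed-instead d = trans (score-erase₂ w α profile j-bribed-instead j≢j' elsewhere d)
        (cong₂ (λ M N → R d + w j * points α M d + w j' * points α N d)
               (updateAt-updates j honest-j')
               (trans (updateAt-minimal j' j honest-j' (j≢j' ∘ sym)) (updateAt-updates j' profile)))
        where
        elsewhere : ∀ l → l ≢ j → l ≢ j' → profile l ≡ j-bribed-instead l
        elsewhere l l≢j l≢j' = trans (honest-j'-elsewhere l l≢j l≢j')
                                     (sym (updateAt-minimal l j honest-j' l≢j))

    withstands-exchange : Withstands VF → Withstands (exchange VF j' j)
    withstands-exchange safe β c c≢cm with j' ∈? Bribery.bribed β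
    ... | no j'∉VB  = safe (against-VF β j'∉VB) c c≢cm
    ... | yes j'∈VB =
      subst₂ _≤_ (sym (score-actual β c)) (sym (score-actual β cm))
        (≤-of-swapped-and-copied (R β c) (R β cm) (X β c) (X β cm) (L c) (L cm) weight-≤
          (subst₂ _≤_ (score-j-bribed-instead β c) (score-j-bribed-instead β cm)
                  (safe (bribe-j-instead β j'∈VB) c c≢cm))
          (subst₂ _≤_ (score-honest-j' β c) (score-honest-j' β cm)
                  (safe (leave-j'-honest β) c c≢cm)))

lemma6 : (I : Instance) → (VF : Subset (Instance.n I)) → (j' j : Fin (Instance.n I)) →
    Succeeds I VF → Dominated I j' j → j' ∈ VF → j ∉ VF →
    Succeeds I ((VF - j') ∪ ⁅ j ⁆)
lemma6 I VF j' j succeeds j'≺j j'∈VF j∉VF =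
  Withstands⇒Succeeds I (≤-trans exchange-affordable (proj₁ succeeds))
                        (withstands-exchange (Succeeds⇒Withstands I succeeds))
  where open Exchange I j'∈VF j∉VF (Dominated⇒WeaklyDominated I j'≺j)
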